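{- Let $\mathcal{Q}$ be a concept of qualified subsets. Then $S_\mathcal{Q}$ satisfies strong retentiveness.
   Context: Let $X$ be a universe of alternatives and $\mathcal{F}(X)$ the non-empty finite subsets of $X$. A tournament $T=(A,\succ)$: $A\in\mathcal{F}(X)$, $\succ$ an asymmetric complete relation on $X$. For $B\subseteq A$ write $B$ also for $(B,\succ)$; $B\succ C$ means $b\succ c$ for all $b\in B, c\in C$; $\overline{D}(a)=\{b\in A:b\succ a\}$; $\max_\prec(B)=\{a\in B:\text{no }b\in B\text{ with }b\succ a\}$. A tournament function depends only on $A$ and $\succ|_A$ and commutes with isomorphisms; a tournament solution is a tournament function $S$ with $\max_\prec(A)\subseteq S(T)\subseteq A$, $S(T)\ne\emptyset$. $\mathcal{M}(T)=\{B\subseteq A:\max_\prec(B)\neq\emptyset\}$, $\mathcal{M}_1(T)$ the singletons. A concept of qualified subsets is a tournament function $\mathcal{Q}$ with $\mathcal{M}_1(T)\subseteq\mathcal{Q}(T)\subseteq\mathcal{M}(T)$ satisfying (Closure) $Q\in\mathcal{Q}(T)$, $Q'\subseteq Q$, $Q'\in\mathcal{M}(T)$ imply $Q'\in\mathcal{Q}(T)$; (Independence) for $A'\in\mathcal{F}(X)$ and $Q\subseteq A\cap A'$, $Q\in\mathcal{Q}((A,\succ))$ iff $Q\in\mathcal{Q}((A',\succ))$; (Fusion) $Q_1,Q_2\in\mathcal{Q}(T)$ and $Q_1\setminus Q_2\succ Q_2$ imply $Q_1\cup Q_2\in\mathcal{Q}(T)$ provided some tournament $T'$ has $Q\in\mathcal{Q}(T')$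 with $|Q_1\cup Q_2|\le |Q|$. $S_\mathcal{Q}(T)=\bigcup\{\max_\prec(B):B\text{ inclusion-maximal in }\mathcal{Q}(T)\}$. A tournament solution $S$ satisfies strong retentiveness if $S(\overline{D}(a))\subseteq S(A)$ for all tournaments $(A,\succ)$ and all $a\in A$ (with $\overline{D}(a)\neq\emptyset$, as $S$ is only defined on non-empty sets). -}

module Defs where

open import Level using (0ℓ)
open import Data.Nat using (ℕ; _≤_)
open import Data.List using (List; length)
open import Data.List.Membership.Propositional using (_∈_)
open import Data.List.Relation.Unary.Unique.Propositional using (Unique)
open import Data.Product using (Σ; ∃; _×_; _,_)
open import Data.Sum using (_⊎_)
open import Relation.Nullary using (¬_)
open import Relation.Unary using (Pred; _⊆_; _∪_; Satisfiable; ｛_｝)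
open import Relation.Binary.PropositionalEquality using (_≡_; _≢_)
open import Function.Bundles using (_⇔_)

private variable X : Set

Subset : Set → Set₁
Subset X = Pred X 0ℓ

Rel₂ : Set → Set₁
Rel₂ X = X → X → Set

_≐_ : Subset X → Subset X → Set
A ≐ B = (A ⊆ B) × (B ⊆ A)

Finite : Subset X → Set
Finite {X} A = Σ (List X) λ xs → ∀ x → A x ⇔ x ∈ xs

HasCard : Subset X → ℕ → Set
HasCard {X} B n = Σ (List X) λ xs → Unique xs × (∀ x → B x ⇔ x ∈ xs) × length xs ≡ n

_≤ᶜ_ : Subset X → Subset X → Set
B ≤ᶜ C = Σ ℕ λ n → Σ ℕ λ m → HasCard B n × HasCard C m × n ≤ m

IsTournamentRel : Rel₂ X → Set
IsTournamentRel {X} _≻_ =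
  (∀ a b → a ≻ b → ¬ (b ≻ a)) × (∀ (a b : X) → a ≢ b → (a ≻ b) ⊎ (b ≻ a))

IsTournament : Subset X → Rel₂ X → Set
IsTournament A _≻_ = Finite A × Satisfiable A × IsTournamentRel _≻_

_⟨_⟩_ : Subset X → Rel₂ X → Subset X → Set
B ⟨ _≻_ ⟩ C = ∀ {b c} → B b → C c → b ≻ c

_∖_ : Subset X → Subset X → Subset X
(B ∖ C) x = B x × ¬ C x

Dom : Subset X → Rel₂ X → X → Subset X
Dom A _≻_ a b = A b × (b ≻ a)

Max : Rel₂ X → Subset X → Subset X
Max {X} _≻_ B a = B a × ¬ (Σ X λ b → B b × (b ≻ a))

M : Subset X → Rel₂ X → Subset X → Set
M A _≻_ B = (B ⊆ A) × Satisfiable (Max _≻_ B)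

Image : (X → X) → Subset X → Subset X
Image {X} f B y = Σ X λ x → B x × (f x ≡ y)

-- a set-of-subsets valued function of tournaments: Q A ≻ B  means  B ∈ Q((A,≻))
SetFamilyFn : Set → Set₁
SetFamilyFn X = Subset X → Rel₂ X → Subset X → Set

IsIso : Subset X → Rel₂ X → Subset X → Rel₂ X → (X → X) → Set
IsIso {X} A _≻_ A' _≻'_ f =
  (∀ {a} → A a → A' (f a)) ×
  (∀ {a b} → A a → A b → f a ≡ f b → a ≡ b) ×
  (∀ {a'} → A' a' → Σ X λ a → A a × (f a ≡ a')) ×
  (∀ {a b} → A a → A b → (a ≻ b) ⇔ (f a ≻' f b))

IsTournamentFunction : SetFamilyFn X → Set₁
IsTournamentFunction {X} Q =
  (∀ A _≻_ A' _≻'_ → IsTournament A _≻_ → IsTournament A' _≻'_ →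
     A ≐ A' → (∀ {a b} → A a → A b → (a ≻ b) ⇔ (a ≻' b)) →
     ∀ B → Q A _≻_ B ⇔ Q A' _≻'_ B) ×
  (∀ A _≻_ A' _≻'_ f → IsTournament A _≻_ → IsTournament A' _≻'_ →
     IsIso A _≻_ A' _≻'_ f →
     ∀ B' → Q A' _≻'_ B' ⇔ (Σ (Subset X) λ B → Q A _≻_ B × (Image f B ≐ B')))

IsConcept : SetFamilyFn X → Set₁
IsConcept {X} Q =
  IsTournamentFunction Q ×
  (∀ A _≻_ → IsTournament A _≻_ → ∀ a → A a → Q A _≻_ ｛ a ｝) ×
  (∀ A _≻_ → IsTournament A _≻_ → ∀ B → Q A _≻_ B → M A _≻_ B) ×
  (∀ A _≻_ → IsTournament A _≻_ → ∀ B B' →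
     Q A _≻_ B → B' ⊆ B → M A _≻_ B' → Q A _≻_ B') ×
  (∀ A A' _≻_ → IsTournament A _≻_ → IsTournament A' _≻_ → ∀ B →
     B ⊆ A → B ⊆ A' → Q A _≻_ B ⇔ Q A' _≻_ B) ×
  (∀ A _≻_ → IsTournament A _≻_ → ∀ Q₁ Q₂ →
     Q A _≻_ Q₁ → Q A _≻_ Q₂ → (Q₁ ∖ Q₂) ⟨ _≻_ ⟩ Q₂ →
     (Σ (Subset X) λ A' → Σ (Rel₂ X) λ _≻'_ → Σ (Subset X) λ B →
        IsTournament A' _≻'_ × Q A' _≻'_ B × ((Q₁ ∪ Q₂) ≤ᶜ B)) →
     Q A _≻_ (Q₁ ∪ Q₂))

InclMax : (Subset X → Set) → Subset X → Set₁
InclMax {X} F B = F B × (∀ (B' : Subset X) → F B' → B ⊆ B' → B' ⊆ B)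

S : SetFamilyFn X → Subset X → Rel₂ X → X → Set₁
S {X} Q A _≻_ x = Σ (Subset X) λ B → InclMax (Q A _≻_) B × Max _≻_ B x

StronglyRetentive : (Subset X → Rel₂ X → X → Set₁) → Set₁
StronglyRetentive {X} Sol =
  ∀ (A : Subset X) (_≻_ : Rel₂ X) → IsTournament A _≻_ →
  ∀ a → A a → Satisfiable (Dom A _≻_ a) →
  ∀ x → Sol (Dom A _≻_ a) _≻_ x → Sol A _≻_ x

-- Let B be inclusion-maximal in Q(D̄(a)) with maximum x. If B ∪ {a} is not qualified in A,
-- then B is already inclusion-maximal in Q(A): a strictly larger qualified set B' witnesses
-- the size condition of Fusion for B and {a}, which would qualify B ∪ {a}. If B ∪ {a} is
-- qualified, every qualified C ⊇ B ∪ {a} has x as its maximum: a maximum y ≠ x would have to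
-- beat x and a, so B ∪ {y} would be a qualified subset of D̄(a) strictly above B. Extending
-- B ∪ {a} to an inclusion-maximal qualified set therefore keeps x as maximum.
module Submission where

open import Defs
open import Level using (0ℓ)
open import Axiom.ExcludedMiddle using (ExcludedMiddle)
open import Data.Nat using (ℕ; suc; _<_)
open import Data.List using (List; []; _∷_; length; filter; deduplicate)
open import Data.List.Properties using (filter-notAll)
open import Data.List.Membership.Propositional using (_∈_; lose)
open import Data.List.Membership.Propositional.Properties
  using (∈-filter⁺; ∈-filter⁻; deduplicate-∈⇔)
open import Data.List.Relation.Unary.Any using (here; there)
open import Data.List.Relation.Unary.All as All using ()
open import Data.List.Relation.Unary.AllPairs using (_∷_)
open import Data.List.Relation.Unary.Unique.DecPropositional.Properties using (deduplicate-!)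
open import Data.List.Relation.Unary.Unique.Propositional.Properties using (filter⁺)
open import Data.Product using (Σ; ∃; _×_; _,_; proj₁; proj₂)
open import Data.Sum using (inj₁; inj₂)
open import Data.Empty using (⊥-elim)
open import Relation.Nullary using (¬_; yes; no)
open import Relation.Unary using (Decidable; _⊆_; _∪_; Satisfiable; ｛_｝)
open import Relation.Binary.Definitions using (DecidableEquality)
open import Relation.Binary.PropositionalEquality using (_≡_; refl; sym; subst)
open import Function.Base using (case_of_)
open import Function.Bundles using (_⇔_; mk⇔; module Equivalence)
open import Function.Construct.Composition using (_⇔-∘_)

open Equivalence using (to; from)

Max-⊆ : {X : Set} {_≻_ : Rel₂ X} {Y C : Subset X} {x : X} → Y ⊆ C → Y x → Max _≻_ C x → Max _≻_ Y x
Max-⊆ Y⊆C Yx (_ , x-top) = Yx , λ (b , Yb , b≻x) → x-top (b , Y⊆C Yb , b≻x)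

module _ {X : Set} (lem : ExcludedMiddle 0ℓ) where

  decide : (P : Subset X) → Decidable P
  decide _ _ = lem

  ∈-filter-decide⇔ : {B : Subset X} (xs : List X) → B ⊆ (_∈ xs) →
                     ∀ x → B x ⇔ x ∈ filter (decide B) xs
  ∈-filter-decide⇔ {B} xs B⊆xs x =
    mk⇔ (λ Bx → ∈-filter⁺ (decide B) (B⊆xs Bx) Bx) (λ x∈ → proj₂ (∈-filter⁻ (decide B) {xs = xs} x∈))

  finite-⊆ : {A B : Subset X} → Finite A → B ⊆ A → Finite B
  finite-⊆ {B = B} (as , A⇔) B⊆A = filter (decide B) as , ∈-filter-decide⇔ as (λ Bx → A⇔ _ .to (B⊆A Bx))

  finite⇒hasCard : {B : Subset X} → Finite B → ∃ (HasCard B)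
  finite⇒hasCard (xs , B⇔) =
    length ys , ys , deduplicate-! _≟_ xs , (λ x → deduplicate-∈⇔ _≟_ ⇔-∘ B⇔ x) , refl
    where
    _≟_ : DecidableEquality X
    _ ≟ _ = lem
    ys : List X
    ys = deduplicate _≟_ xs

  hasCard-⊂ : {B B' : Subset X} {m : ℕ} {z : X} → HasCard B' m → B ⊆ B' → B' z → ¬ B z →
              ∃ λ n → HasCard B n × n < m
  hasCard-⊂ {B} (ys , unique , B'⇔ , refl) B⊆B' B'z ¬Bz =
    length bs ,
    (bs , filter⁺ (decide B) unique , ∈-filter-decide⇔ ys (λ Bx → B'⇔ _ .to (B⊆B' Bx)) , refl) ,
    filter-notAll (decide B) ys (lose (B'⇔ _ .to B'z) ¬Bz)
    where
    bs : List X
    bs = filter (decide B) ys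

  hasCard-∪-｛｝ : {B : Subset X} {n : ℕ} {a : X} → HasCard B n → ¬ B a → HasCard (B ∪ ｛ a ｝) (suc n)
  hasCard-∪-｛｝ {B} {a = a} (bs , unique , B⇔ , refl) ¬Ba =
    a ∷ bs , All.tabulate (λ x∈ a≡x → ¬Ba (subst B (sym a≡x) (B⇔ _ .from x∈))) ∷ unique ,
    (λ x → mk⇔ (into x) (outof x)) , refl
    where
    into : ∀ x → (B ∪ ｛ a ｝) x → x ∈ a ∷ bs
    into x (inj₁ Bx) = there (B⇔ x .to Bx)
    into x (inj₂ refl) = here refl
    outof : ∀ x → x ∈ a ∷ bs → (B ∪ ｛ a ｝) x
    outof x (here refl) = inj₂ refl
    outof x (there x∈) = inj₁ (B⇔ x .from x∈)

  ∪-｛｝-≤ᶜ : {B B' : Subset X} {a z : X} → Finite B' → B ⊆ B' → B' z → ¬ B z → ¬ B a →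
              (B ∪ ｛ a ｝) ≤ᶜ B'
  ∪-｛｝-≤ᶜ finB' B⊆B' B'z ¬Bz ¬Ba =
    let (m , cardB') = finite⇒hasCard finB'
        (n , cardB , n<m) = hasCard-⊂ cardB' B⊆B' B'z ¬Bz
    in suc n , m , hasCard-∪-｛｝ cardB ¬Ba , cardB' , n<m

  Convex : (Subset X → Set) → Set₁
  Convex F = ∀ {C Y C'} → F C → F C' → C ⊆ Y → Y ⊆ C' → F Y

  module _ {F : Subset X → Set} (convex : Convex F) where

    grow : List X → Subset X → Subset X
    grow [] C = C
    grow (e ∷ es) C with lem {F (C ∪ ｛ e ｝)}
    ... | yes _ = grow es (C ∪ ｛ e ｝)
    ... | no _ = grow es C

    grow-⊇ : ∀ es {C} → F C → F (grow es C) × C ⊆ grow es C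
    grow-⊇ [] FC = FC , λ c → c
    grow-⊇ (e ∷ es) {C} FC with lem {F (C ∪ ｛ e ｝)}
    ... | yes FCe = let (FG , Ce⊆G) = grow-⊇ es FCe in FG , λ c → Ce⊆G (inj₁ c)
    ... | no _ = grow-⊇ es FC

    grow-saturated : ∀ es {C C'} → F C → F C' → grow es C ⊆ C' → ∀ {e} → e ∈ es → C' e → grow es C e
    grow-saturated (e ∷ es) {C} {C'} FC FC' G⊆C' (here refl) C'e with lem {F (C ∪ ｛ e ｝)}
    ... | yes FCe = proj₂ (grow-⊇ es FCe) (inj₂ refl)
    ... | no ¬FCe = ⊥-elim (¬FCe (convex FC FC' inj₁ Ce⊆C'))
      where
      Ce⊆C' : C ∪ ｛ e ｝ ⊆ C'
      Ce⊆C' (inj₁ c) = G⊆C' (proj₂ (grow-⊇ es FC) c)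
      Ce⊆C' (inj₂ refl) = C'e
    grow-saturated (e ∷ es) {C} FC FC' G⊆C' (there e∈es) C'e with lem {F (C ∪ ｛ e ｝)}
    ... | yes FCe = grow-saturated es FCe FC' G⊆C' e∈es C'e
    ... | no _ = grow-saturated es FC FC' G⊆C' e∈es C'e

    extend-to-InclMax : (es : List X) → (∀ {C} → F C → C ⊆ (_∈ es)) →
                        ∀ {C} → F C → Σ (Subset X) λ C* → C ⊆ C* × InclMax F C*
    extend-to-InclMax es bounded {C} FC =
      grow es C , proj₂ (grow-⊇ es FC) , proj₁ (grow-⊇ es FC) ,
      λ C' FC' G⊆C' C'x → grow-saturated es FC FC' G⊆C' (bounded FC' C'x) C'x

  Dom-isTournament : {A : Subset X} {_≻_ : Rel₂ X} {a : X} →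
                     IsTournament A _≻_ → Satisfiable (Dom A _≻_ a) → IsTournament (Dom A _≻_ a) _≻_
  Dom-isTournament (finA , _ , tournament) satD = finite-⊆ finA proj₁ , satD , tournament

  inclMax-of-¬fusable : {Q : SetFamilyFn X} {A B : Subset X} {_≻_ : Rel₂ X} {a : X} →
                        IsConcept Q → IsTournament A _≻_ → A a → Q A _≻_ B → B ⟨ _≻_ ⟩ ｛ a ｝ →
                        ¬ Q A _≻_ (B ∪ ｛ a ｝) → InclMax (Q A _≻_) B
  inclMax-of-¬fusable {Q} {A} {B} {_≻_} {a} (_ , singleton , qualified⇒M , _ , _ , fusion)
                      tA@(finA , _ , asym , _) Aa QB B≻a ¬QBa = QB , B-maximal
    where
    ¬Ba : ¬ B a
    ¬Ba Ba = asym a a (B≻a Ba refl) (B≻a Ba refl)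

    B-maximal : ∀ B' → Q A _≻_ B' → B ⊆ B' → B' ⊆ B
    B-maximal B' QB' B⊆B' {z} B'z with lem {B z}
    ... | yes Bz = Bz
    ... | no ¬Bz = ⊥-elim (¬QBa (fusion _ _ tA B ｛ a ｝ QB (singleton _ _ tA a Aa)
                                   (λ (Bb , _) → B≻a Bb) (A , _≻_ , B' , tA , QB' , size)))
      where
      size : (B ∪ ｛ a ｝) ≤ᶜ B'
      size = ∪-｛｝-≤ᶜ (finite-⊆ finA (proj₁ (qualified⇒M _ _ tA B' QB'))) B⊆B' B'z ¬Bz ¬Ba

  maximum-of-extension : {Q : SetFamilyFn X} {A B C : Subset X} {_≻_ : Rel₂ X} {a x : X} →
                         IsConcept Q → IsTournament A _≻_ → IsTournament (Dom A _≻_ a) _≻_ →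
                         InclMax (Q (Dom A _≻_ a) _≻_) B → Max _≻_ B x →
                         Q A _≻_ C → B ∪ ｛ a ｝ ⊆ C → Max _≻_ C x
  maximum-of-extension {Q} {A} {B} {C} {_≻_} {a} {x} (_ , _ , qualified⇒M , closure , independence , _)
                       tA@(_ , _ , asym , complete) tD (QB , B-maximal) (Bx , x-top) QC Ba⊆C
    with qualified⇒M _ _ tA C QC
  ... | C⊆A , y , y-max@(Cy , y-top) = subst (Max _≻_ C) y≡x y-max
    where
    B⊆D : B ⊆ Dom A _≻_ a
    B⊆D = proj₁ (qualified⇒M _ _ tD B QB)

    By⊆C : B ∪ ｛ y ｝ ⊆ C
    By⊆C (inj₁ Bb) = Ba⊆C (inj₁ Bb)
    By⊆C (inj₂ refl) = Cy

    By⊆D : y ≻ a → B ∪ ｛ y ｝ ⊆ Dom A _≻_ a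
    By⊆D _ (inj₁ Bb) = B⊆D Bb
    By⊆D y≻a (inj₂ refl) = C⊆A Cy , y≻a

    QBy : y ≻ a → Q (Dom A _≻_ a) _≻_ (B ∪ ｛ y ｝)
    QBy y≻a = independence _ _ _ tD tA _ (By⊆D y≻a) (λ b → C⊆A (By⊆C b)) .from
                (closure _ _ tA C _ QC By⊆C
                  ((λ b → C⊆A (By⊆C b)) , y , Max-⊆ {_≻_ = _≻_} By⊆C (inj₂ refl) y-max))

    y≡x : y ≡ x
    y≡x with lem {y ≡ x}
    ... | yes y≡x = y≡x
    ... | no y≢x with complete y x y≢x
    ...   | inj₂ x≻y = ⊥-elim (y-top (x , Ba⊆C (inj₁ Bx) , x≻y))
    ...   | inj₁ y≻x with complete y a (λ { refl → asym x a (proj₂ (B⊆D Bx)) y≻x })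
    ...     | inj₂ a≻y = ⊥-elim (y-top (a , Ba⊆C (inj₂ refl) , a≻y))
    ...     | inj₁ y≻a = ⊥-elim (x-top (y , B-maximal _ (QBy y≻a) inj₁ (inj₂ refl) , y≻x))

  S-of-fusable : {Q : SetFamilyFn X} {A B : Subset X} {_≻_ : Rel₂ X} {a x : X} →
                 IsConcept Q → IsTournament A _≻_ → IsTournament (Dom A _≻_ a) _≻_ →
                 InclMax (Q (Dom A _≻_ a) _≻_) B → Max _≻_ B x →
                 Q A _≻_ (B ∪ ｛ a ｝) → S Q A _≻_ x
  S-of-fusable {Q} {A} {B} {_≻_} {a} {x} concept@(_ , _ , qualified⇒M , closure , _ , _)
               tA@((as , A⇔) , _) tD B-inclMax Bx-max@(Bx , _) QBa =
    let (C , Ba⊆C , (QC , _) , C-maximal) = extend-to-InclMax convex as bounded (QBa , λ b → b)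
    in C , (QC , λ C' QC' C⊆C' → C-maximal C' (QC' , λ b → C⊆C' (Ba⊆C b)) C⊆C') ,
       x-max QC Ba⊆C
    where
    Extension : Subset X → Set
    Extension C = Q A _≻_ C × (B ∪ ｛ a ｝ ⊆ C)

    x-max : ∀ {C} → Q A _≻_ C → B ∪ ｛ a ｝ ⊆ C → Max _≻_ C x
    x-max = maximum-of-extension concept tA tD B-inclMax Bx-max

    convex : Convex Extension
    convex (_ , Ba⊆C) (QC' , Ba⊆C') C⊆Y Y⊆C' =
      closure _ _ tA _ _ QC' Y⊆C'
        ((λ y → proj₁ (qualified⇒M _ _ tA _ QC') (Y⊆C' y)) ,
         x , Max-⊆ {_≻_ = _≻_} Y⊆C' (C⊆Y (Ba⊆C (inj₁ Bx))) (x-max QC' Ba⊆C')) ,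
      λ b → C⊆Y (Ba⊆C b)

    bounded : ∀ {C} → Extension C → C ⊆ (_∈ as)
    bounded (QC , _) Cc = A⇔ _ .to (proj₁ (qualified⇒M _ _ tA _ QC) Cc)

lemma1 : {X : Set} → ExcludedMiddle 0ℓ → (Q : SetFamilyFn X) → IsConcept Q → StronglyRetentive (S Q)
lemma1 lem Q concept@(_ , _ , qualified⇒M , _ , independence , _) A _≻_ tA a Aa satD x
       (B , B-inclMax@(QB , _) , Bx-max) =
  case lem {Q A _≻_ (B ∪ ｛ a ｝)} of λ where
    (yes QBa) → S-of-fusable lem concept tA tD B-inclMax Bx-max QBa
    (no ¬QBa) → B , inclMax-of-¬fusable lem concept tA Aa QAB B≻a ¬QBa , Bx-max
  where
  tD : IsTournament (Dom A _≻_ a) _≻_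
  tD = Dom-isTournament lem tA satD
  B⊆D : B ⊆ Dom A _≻_ a
  B⊆D = proj₁ (qualified⇒M _ _ tD B QB)
  QAB : Q A _≻_ B
  QAB = independence _ _ _ tD tA B B⊆D (λ b → proj₁ (B⊆D b)) .to QB
  B≻a : B ⟨ _≻_ ⟩ ｛ a ｝
  B≻a Bb refl = proj₂ (B⊆D Bb)
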